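{- Assume the setting of the context, with integers $0\le d<e\le\lambda_1$, and let $(S,T)\in\boldsymbol{S}_{(d,e)}$. Then $U(S,T)\subseteq\rho/e$.
   Context: Fix integers $N \ge n\ge 1$ and partitions $\rho=(\rho_1,\ldots,\rho_n)$, $\lambda=(\lambda_1,\ldots,\lambda_n)$ (weakly decreasing nonnegative integers) such that there is exactly one $r$ with $\lambda_r=\rho_r-1$ and $\lambda_i=\rho_i$ for $i\ne r$. Position $(i,j)$ means row $i$, column $j$; shapes are identified with their sets of positions. For an integer $d$, $\rho/d$ is the skew shape obtained from the Young diagram of $\rho$ by removing the first $d$ boxes of the first row (similarly $\lambda/e$). A skew SSYT is a filling of a skew shape with positive integers satisfying the "skew SSYT requirements": entries weakly increase along rows and strictly increase down columns. $\boldsymbol{S}_{(d,e)}$ is the set of pairs $(S,T)$ with $S$ a skew SSYT of shape $\rho/d$ and $T$ a skew SSYT of shape $\lambda/e$, both with entries in $\{1,\ldots,N-1\}$; $S_{i,j}$ denotes an entry. For $(S,T)\in\boldsymbol{S}_{(d,e)}$ use the convention $T_{1,j}=0$ for $d<j\le e$, and a box with entry $0$ is regarded as missing. For a set $U$ of positions in $\rho/d$ containing $(r,\rho_r)$, $S'_U$ is obtained from $T$ by adding a box at $(r,\rho_r)$ with entry $S_{r,\rho_r}$ and replacing $T_{i,j}$ by $S_{i,j}$ for each $(i,j)\in U\setminus\{(r,\rho_r)\}$; $T'_U$ is obtained from $S$ by removing the box at $(r,\rho_r)$ and replacing $S_{i,j}$ by $T_{i,j}$ for each $(i,j)\in U\setminus\{(r,\rho_r)\}$.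 A sequence $\{(B_k,C_k)\}_{1\le k\le M}$ ($M\ge0$) of pairs of positions in $\rho/d$ is a spanning tree for $(S,T)$ if, with $B_0=(r,\rho_r)$ and $U_K=\{B_0,\ldots,B_K\}$: (1) $B_k\in\rho/d\setminus U_{k-1}$ and $C_k\in U_{k-1}$ for each $k$; (2) $B_k$ and $C_k$ are adjacent; (3) for each $k$, $S'_{U_{k-1}}$ and $T'_{U_{k-1}}$ are not both skew SSYT's, and $(B_k,C_k)$ is a pair of adjacent positions at which one or both of them fail the skew SSYT requirements; (4) there is no pair $(B_{M+1},C_{M+1})$ of adjacent positions at which $S'_{U_M}$ or $T'_{U_M}$ fails the skew SSYT requirements. The set $U_M$ does not depend on the choice of spanning tree and is denoted $U(S,T)$. -}

module Defs where

open import Data.Nat using (ℕ; zero; suc; _≤_; _<_; _∸_)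
open import Data.Nat.Properties using (_≟_; _≤?_)
open import Data.Product using (_×_; _,_; proj₁; proj₂)
open import Data.Product.Properties using (≡-dec)
open import Data.Sum using (_⊎_)
open import Data.Vec using (Vec; []; _∷_)
open import Data.List using (List; []; _∷_)
open import Data.List.Membership.Propositional using (_∈_)
open import Data.List.Membership.DecPropositional (≡-dec _≟_ _≟_) using (_∈?_)
open import Relation.Nullary using (¬_; yes; no)
open import Relation.Binary.PropositionalEquality using (_≡_)

-- Positions (i , j) = (row , column), 1-based.
Pos : Set
Pos = ℕ × ℕ

-- Length of row i (1-based) of a partition given as a vector of length n;
-- rows 0 and i > n have length 0.
row : {n : ℕ} → Vec ℕ n → ℕ → ℕ
row v zero = 0
row [] (suc i) = 0
row (x ∷ v) (suc zero) = x
row (x ∷ v) (suc (suc i)) = row v (suc i)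

IsPartition : {n : ℕ} → Vec ℕ n → Set
IsPartition v = ∀ i j → 1 ≤ i → i ≤ j → row v j ≤ row v i

-- μ / d : Young diagram of μ with the first d boxes of the first row removed
InSkew : {n : ℕ} → Vec ℕ n → ℕ → Pos → Set
InSkew μ d (i , j) = (1 ≤ j) × (j ≤ row μ i) × (i ≡ 1 → d < j)

Shape : Set₁
Shape = Pos → Set

Filling : Set
Filling = Pos → ℕ

IsSkewSSYT : ℕ → Shape → Filling → Set
IsSkewSSYT N sh F =
  (∀ p → sh p → (1 ≤ F p) × (F p ≤ N ∸ 1)) ×
  (∀ i j → sh (i , j) → sh (i , suc j) → F (i , j) ≤ F (i , suc j)) ×
  (∀ i j → sh (i , j) → sh (suc i , j) → F (i , j) < F (suc i , j))

HorizNext : Pos → Pos → Set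
HorizNext (i , j) (i' , j') = (i' ≡ i) × (j' ≡ suc j)

VertNext : Pos → Pos → Set
VertNext (i , j) (i' , j') = (i' ≡ suc i) × (j' ≡ j)

Adjacent : Pos → Pos → Set
Adjacent a b = HorizNext a b ⊎ HorizNext b a ⊎ VertNext a b ⊎ VertNext b a

-- the filling F of shape sh fails the skew SSYT requirements at the
-- ordered pair (a , b), a left of / above b (entries compared as numbers;
-- entry 0 encodes a missing box)
FailsDir : Shape → Filling → Pos → Pos → Set
FailsDir sh F a b =
  sh a × sh b × ((HorizNext a b × F b < F a) ⊎ (VertNext a b × F b ≤ F a))

FailsAt : Shape → Filling → Pos → Pos → Set
FailsAt sh F p q = FailsDir sh F p q ⊎ FailsDir sh F q p

-- T extended by the convention T_{1,j} = 0 for j ≤ e (in particular d < j ≤ e)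
Tz : ℕ → Filling → Filling
Tz e T (i , j) with i ≟ 1 | j ≤? e
... | yes _ | yes _ = 0
... | _ | _ = T (i , j)

-- S'_U : from T, add box B0 with entry S_{B0}, replace entries on U by S
S′ : ℕ → Filling → Filling → List Pos → Filling
S′ e S T U p with p ∈? U
... | yes _ = S p
... | no _ = Tz e T p

-- T'_U : from S, remove box B0, replace entries on U \ {B0} by T
-- (its shape is ρ/d minus B0, i.e. λ/d; the value at B0 is irrelevant)
T′ : ℕ → Filling → Filling → List Pos → Filling
T′ e S T U p with p ∈? U
... | yes _ = Tz e T p
... | no _ = S p

Fails : {n : ℕ} → Vec ℕ n → Vec ℕ n → ℕ → ℕ → Filling → Filling → List Pos →
        Pos → Pos → Set
Fails ρ lam d e S T U p q =
  FailsAt (InSkew ρ d) (S′ e S T U) p q ⊎ FailsAt (InSkew lam d) (T′ e S T U) p q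

-- IsSpanningTreeFrom … U seq : the sequence seq = ((B_k , C_k))_k is a valid
-- continuation starting from the current set U = U_{k-1} (conditions (1)-(4)).
IsSpanningTreeFrom : {n : ℕ} → Vec ℕ n → Vec ℕ n → ℕ → ℕ → Filling → Filling →
                     List Pos → List (Pos × Pos) → Set
IsSpanningTreeFrom ρ lam d e S T U [] =
  ∀ p q → Adjacent p q → ¬ Fails ρ lam d e S T U p q
IsSpanningTreeFrom ρ lam d e S T U ((B , C) ∷ rest) =
  InSkew ρ d B × ¬ (B ∈ U) × C ∈ U × Adjacent B C ×
  Fails ρ lam d e S T U B C ×
  IsSpanningTreeFrom ρ lam d e S T (B ∷ U) rest

finalU : List Pos → List (Pos × Pos) → List Pos
finalU U [] = U
finalU U ((B , C) ∷ rest) = finalU (B ∷ U) rest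

{-# OPTIONS --safe #-}
module Submission where

-- Every box B ≠ B₀ entering U satisfies S_B < T_B, where T is padded with zeros on
-- the first e boxes of row 1. A violation at (B, C) with C already in U either forces
-- this for B or contradicts it for C, because S is ordered along the rows and columns
-- of ρ/d and the padded T along those of λ/d. As T_B > 0, such a B is not among the
-- first e boxes of row 1, so B ∈ λ/e ⊆ ρ/e; and B₀ ∈ ρ/e since e ≤ λ₁ < ρ₁ when r = 1.

open import Defs
open import Data.Nat using (ℕ; _≤_; _<_; suc; _+_; z≤n; s≤s)
open import Data.Nat.Properties
open import Data.Product using (_×_; _,_; proj₁; Σ)
open import Data.Product.Properties using (≡-dec)
open import Data.Sum using (_⊎_; inj₁; inj₂)
open import Data.Empty using (⊥; ⊥-elim)
open import Data.Vec using (Vec)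
open import Data.List using (List; []; _∷_)
open import Data.List.Relation.Unary.All using (All; []; _∷_; lookup)
open import Data.List.Membership.Propositional using (_∈_)
open import Data.List.Membership.DecPropositional (≡-dec _≟_ _≟_) using (_∈?_)
open import Relation.Nullary using (¬_; yes; no; Dec)
open import Relation.Nullary.Decidable using (_×-dec_)
open import Relation.Binary.PropositionalEquality using (_≡_; refl; sym; trans; subst; subst₂; cong)

data Dir : Set where
  horizontal vertical : Dir

Next : Dir → Pos → Pos → Set
Next horizontal = HorizNext
Next vertical   = VertNext

-- x ≼⟨ δ ⟩ y is the order an SSYT requires of consecutive entries x, y in
-- direction δ; y ≺⟨ δ ⟩ x is its negation, the form in which FailsDir records a violation.
_≼⟨_⟩_ : ℕ → Dir → ℕ → Set
x ≼⟨ horizontal ⟩ y = x ≤ y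
x ≼⟨ vertical ⟩   y = x < y

_≺⟨_⟩_ : ℕ → Dir → ℕ → Set
x ≺⟨ horizontal ⟩ y = x < y
x ≺⟨ vertical ⟩   y = x ≤ y

≼⇒≤ : ∀ {x y} δ → x ≼⟨ δ ⟩ y → x ≤ y
≼⇒≤ horizontal = λ x≤y → x≤y
≼⇒≤ vertical   = <⇒≤

≺⇒≤ : ∀ {x y} δ → x ≺⟨ δ ⟩ y → x ≤ y
≺⇒≤ horizontal = <⇒≤
≺⇒≤ vertical   = λ x≤y → x≤y

≼-≺-trans : ∀ {x y z} δ → x ≼⟨ δ ⟩ y → y ≺⟨ δ ⟩ z → x < z
≼-≺-trans horizontal = ≤-<-trans
≼-≺-trans vertical   = <-≤-trans

≺-≼-trans : ∀ {x y z} δ → x ≺⟨ δ ⟩ y → y ≼⟨ δ ⟩ z → x < z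
≺-≼-trans horizontal = <-≤-trans
≺-≼-trans vertical   = ≤-<-trans

FailsDir-view : ∀ {sh F} a b → FailsDir sh F a b →
                sh a × sh b × Σ Dir (λ δ → Next δ a b × F b ≺⟨ δ ⟩ F a)
FailsDir-view _ _ (a∈ , b∈ , inj₁ (next , lt)) = a∈ , b∈ , horizontal , next , lt
FailsDir-view _ _ (a∈ , b∈ , inj₂ (next , le)) = a∈ , b∈ , vertical , next , le

SSYT-monotone : ∀ {N sh F} → IsSkewSSYT N sh F →
                ∀ δ a b → Next δ a b → sh a → sh b → F a ≼⟨ δ ⟩ F b
SSYT-monotone (_ , rows , _) horizontal (i , j) _ (refl , refl) = rows i j
SSYT-monotone (_ , _ , cols) vertical   (i , j) _ (refl , refl) = cols i j

InFirstRowUpTo : ℕ → Pos → Set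
InFirstRowUpTo e (i , j) = i ≡ 1 × j ≤ e

InFirstRowUpTo? : ∀ e p → Dec (InFirstRowUpTo e p)
InFirstRowUpTo? e (i , j) = (i ≟ 1) ×-dec (j ≤? e)

Tz-prefix : ∀ e T p → InFirstRowUpTo e p → Tz e T p ≡ 0
Tz-prefix e T (i , j) (i≡1 , j≤e) with i ≟ 1 | j ≤? e
... | yes _  | yes _ = refl
... | yes _  | no j≰e = ⊥-elim (j≰e j≤e)
... | no i≢1 | _      = ⊥-elim (i≢1 i≡1)

Tz-nonprefix : ∀ e T p → ¬ InFirstRowUpTo e p → Tz e T p ≡ T p
Tz-nonprefix e T (i , j) ¬pre with i ≟ 1 | j ≤? e
... | yes i≡1 | yes j≤e = ⊥-elim (¬pre (i≡1 , j≤e))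
... | yes _   | no _    = refl
... | no _    | _       = refl

skew-nonprefix : ∀ {n k e} {μ : Vec ℕ n} p →
                 InSkew μ k p → ¬ InFirstRowUpTo e p → InSkew μ e p
skew-nonprefix (i , j) (1≤j , j≤μᵢ , _) ¬pre =
  1≤j , j≤μᵢ , λ i≡1 → ≰⇒> (λ j≤e → ¬pre (i≡1 , j≤e))

nonprefix-next : ∀ {n k e} {μ : Vec ℕ n} δ a b → Next δ a b →
                 InSkew μ k a → ¬ InFirstRowUpTo e a → ¬ InFirstRowUpTo e b
nonprefix-next horizontal (i , j) _ (refl , refl) _ ¬pre (i≡1 , j+1≤e) =
  ¬pre (i≡1 , ≤-trans (n≤1+n j) j+1≤e)
nonprefix-next vertical (0 , j) _ (refl , refl) (1≤j , j≤0 , _) _ _ = n≮0 (≤-trans 1≤j j≤0)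

module PaddedFilling (N : ℕ) {n : ℕ} (lam : Vec ℕ n) (e : ℕ) (T : Filling)
                     (T-ssyt : IsSkewSSYT N (InSkew lam e) T) where

  T-monotone : ∀ δ a b → Next δ a b → InSkew lam e a → InSkew lam e b → T a ≼⟨ δ ⟩ T b
  T-monotone = SSYT-monotone {N} {InSkew lam e} {T} T-ssyt

  T-positive : ∀ p → InSkew lam e p → 0 < T p
  T-positive p p∈ = proj₁ (proj₁ T-ssyt p p∈)

  -- Zeros only occur at the start of row 1, so padding keeps rows and columns ordered.
  Tz-monotone : ∀ {k} δ a b → Next δ a b → InSkew lam k a → InSkew lam k b →
                Tz e T a ≼⟨ δ ⟩ Tz e T b
  Tz-monotone {k} δ a b next a∈ b∈ with InFirstRowUpTo? e a
  ... | yes a-pre = subst (λ x → x ≼⟨ δ ⟩ Tz e T b) (sym (Tz-prefix e T a a-pre))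
                      (zero-≼ δ a next a-pre)
    where
    zero-≼ : ∀ δ a → Next δ a b → InFirstRowUpTo e a → 0 ≼⟨ δ ⟩ Tz e T b
    zero-≼ horizontal _ _ _ = z≤n
    zero-≼ vertical _ (refl , refl) (refl , _) =
      subst (0 <_) (sym (Tz-nonprefix e T b b-nonprefix))
        (T-positive b (skew-nonprefix {k = k} {μ = lam} b b∈ b-nonprefix))
      where
      b-nonprefix : ¬ InFirstRowUpTo e b
      b-nonprefix (() , _)
  ... | no a-nonprefix =
    subst₂ (λ x y → x ≼⟨ δ ⟩ y)
      (sym (Tz-nonprefix e T a a-nonprefix)) (sym (Tz-nonprefix e T b b-nonprefix))
      (T-monotone δ a b next
        (skew-nonprefix {k = k} {μ = lam} a a∈ a-nonprefix)
        (skew-nonprefix {k = k} {μ = lam} b b∈ b-nonprefix))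
    where
    b-nonprefix : ¬ InFirstRowUpTo e b
    b-nonprefix = nonprefix-next {k = k} {μ = lam} δ a b next a∈ a-nonprefix

module _ {e : ℕ} {S T : Filling} {U : List Pos} {p : Pos} where

  S′-∈ : p ∈ U → S′ e S T U p ≡ S p
  S′-∈ p∈U with p ∈? U
  ... | yes _ = refl
  ... | no p∉U = ⊥-elim (p∉U p∈U)

  S′-∉ : ¬ p ∈ U → S′ e S T U p ≡ Tz e T p
  S′-∉ p∉U with p ∈? U
  ... | yes p∈U = ⊥-elim (p∉U p∈U)
  ... | no _ = refl

  T′-∈ : p ∈ U → T′ e S T U p ≡ Tz e T p
  T′-∈ p∈U with p ∈? U
  ... | yes _ = refl
  ... | no p∉U = ⊥-elim (p∉U p∈U)

  T′-∉ : ¬ p ∈ U → T′ e S T U p ≡ S p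
  T′-∉ p∉U with p ∈? U
  ... | yes p∈U = ⊥-elim (p∉U p∈U)
  ... | no _ = refl

module RemovableBox {n : ℕ} (ρ lam : Vec ℕ n) (lam-partition : IsPartition lam)
                    (r : ℕ) (1≤r : 1 ≤ r)
                    (row-r : row lam r + 1 ≡ row ρ r)
                    (row-i : ∀ i → ¬ (i ≡ r) → row lam i ≡ row ρ i) where

  B₀ : Pos
  B₀ = (r , row ρ r)

  ρᵣ≡1+λᵣ : row ρ r ≡ suc (row lam r)
  ρᵣ≡1+λᵣ = trans (sym row-r) (+-comm (row lam r) 1)

  row-lam≤row-ρ : ∀ i → row lam i ≤ row ρ i
  row-lam≤row-ρ i with i ≟ r
  ... | yes refl = subst (row lam i ≤_) (sym ρᵣ≡1+λᵣ) (n≤1+n _)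
  ... | no i≢r = ≤-reflexive (row-i i i≢r)

  λ⊆ρ : ∀ {k} p → InSkew lam k p → InSkew ρ k p
  λ⊆ρ (i , j) (1≤j , j≤λᵢ , c) = 1≤j , ≤-trans j≤λᵢ (row-lam≤row-ρ i) , c

  ρ⊆B₀∪λ : ∀ {k} p → InSkew ρ k p → p ≡ B₀ ⊎ InSkew lam k p
  ρ⊆B₀∪λ (i , j) (1≤j , j≤ρᵢ , c) with i ≟ r
  ... | no i≢r = inj₂ (1≤j , subst (j ≤_) (sym (row-i i i≢r)) j≤ρᵢ , c)
  ... | yes refl with j ≤? row lam i
  ...   | yes j≤λᵢ = inj₂ (1≤j , j≤λᵢ , c)
  ...   | no j≰λᵢ =
    inj₁ (cong (i ,_) (≤-antisym j≤ρᵢ (subst (_≤ j) (sym ρᵣ≡1+λᵣ) (≰⇒> j≰λᵢ))))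

  B₀∉λ : ∀ {k} → ¬ InSkew lam k B₀
  B₀∉λ (_ , ρᵣ≤λᵣ , _) = 1+n≰n (subst (_≤ row lam r) ρᵣ≡1+λᵣ ρᵣ≤λᵣ)

  B₀-corner : ∀ {k} δ q → Next δ B₀ q → ¬ InSkew ρ k q
  B₀-corner horizontal _ (refl , refl) (_ , ρᵣ+1≤ρᵣ , _) = 1+n≰n ρᵣ+1≤ρᵣ
  B₀-corner vertical _ (refl , refl) (_ , ρᵣ≤ρᵣ₊₁ , _) =
    1+n≰n (subst (_≤ row lam r) ρᵣ≡1+λᵣ (begin
      row ρ r         ≤⟨ ρᵣ≤ρᵣ₊₁ ⟩
      row ρ (suc r)   ≡⟨ sym (row-i (suc r) 1+n≢n) ⟩
      row lam (suc r) ≤⟨ lam-partition r (suc r) 1≤r (n≤1+n r) ⟩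
      row lam r       ∎))
    where open ≤-Reasoning

  B₀∈ρ/e : ∀ {e} → e ≤ row lam 1 → InSkew ρ e B₀
  B₀∈ρ/e {e} e≤λ₁ =
    subst (1 ≤_) (sym ρᵣ≡1+λᵣ) (s≤s z≤n) , ≤-refl ,
    λ { refl → subst (e <_) (sym ρᵣ≡1+λᵣ) (s≤s e≤λ₁) }

module SpanningTree (N : ℕ) {n : ℕ} (ρ lam : Vec ℕ n) (lam-partition : IsPartition lam)
                    (r : ℕ) (1≤r : 1 ≤ r)
                    (row-r : row lam r + 1 ≡ row ρ r)
                    (row-i : ∀ i → ¬ (i ≡ r) → row lam i ≡ row ρ i)
                    (d e : ℕ) (S T : Filling)
                    (S-ssyt : IsSkewSSYT N (InSkew ρ d) S)
                    (T-ssyt : IsSkewSSYT N (InSkew lam e) T) where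

  open RemovableBox ρ lam lam-partition r 1≤r row-r row-i
  open PaddedFilling N lam e T T-ssyt using (Tz-monotone)

  S-monotone : ∀ δ a b → Next δ a b → InSkew ρ d a → InSkew ρ d b → S a ≼⟨ δ ⟩ S b
  S-monotone = SSYT-monotone {N} {InSkew ρ d} {S} S-ssyt

  S<T : Pos → Set
  S<T p = InSkew lam d p × S p < Tz e T p

  Admissible : Pos → Set
  Admissible p = p ≡ B₀ ⊎ S<T p

  S<T⇒ρ/e : ∀ p → S<T p → InSkew ρ e p
  S<T⇒ρ/e p (p∈λ/d , Sp<Tp) = λ⊆ρ p (skew-nonprefix p p∈λ/d nonprefix)
    where
    nonprefix : ¬ InFirstRowUpTo e p
    nonprefix pre = n≮0 (subst (S p <_) (Tz-prefix e T p pre) Sp<Tp)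

  admissible⇒ρ/e : e ≤ row lam 1 → ∀ p → Admissible p → InSkew ρ e p
  admissible⇒ρ/e e≤λ₁ _ (inj₁ refl) = B₀∈ρ/e e≤λ₁
  admissible⇒ρ/e _    p (inj₂ p-S<T) = S<T⇒ρ/e p p-S<T

  admissible-in-λ : ∀ p → Admissible p → InSkew lam d p → S<T p
  admissible-in-λ _ (inj₁ refl) p∈λ = ⊥-elim (B₀∉λ p∈λ)
  admissible-in-λ _ (inj₂ p-S<T) _ = p-S<T

  admissible-before : ∀ δ p q → Next δ p q → InSkew ρ d q → Admissible p → S<T p
  admissible-before δ _ q next q∈ρ (inj₁ refl) = ⊥-elim (B₀-corner δ q next q∈ρ)
  admissible-before _ _ _ _ _ (inj₂ p-S<T) = p-S<T

  S<Tz⇒admissible : ∀ p → InSkew ρ d p → S p < Tz e T p → Admissible p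
  S<Tz⇒admissible p p∈ρ lt with ρ⊆B₀∪λ p p∈ρ
  ... | inj₁ p≡B₀ = inj₁ p≡B₀
  ... | inj₂ p∈λ = inj₂ (p∈λ , lt)

  module _ (U : List Pos) (B C : Pos) (B∉U : ¬ B ∈ U) (C∈U : C ∈ U)
           (C-adm : Admissible C) where

    S′-fails-forward : FailsDir (InSkew ρ d) (S′ e S T U) B C → Admissible B
    S′-fails-forward fails with FailsDir-view B C fails
    ... | B∈ , C∈ , δ , next , viol =
      S<Tz⇒admissible B B∈ (≼-≺-trans δ (S-monotone δ B C next B∈ C∈)
        (subst₂ (λ x y → x ≺⟨ δ ⟩ y) (S′-∈ C∈U) (S′-∉ B∉U) viol))

    S′-fails-backward : FailsDir (InSkew ρ d) (S′ e S T U) C B → Admissible B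
    S′-fails-backward fails with FailsDir-view C B fails
    ... | C∈ , B∈ , δ , next , viol with ρ⊆B₀∪λ B B∈
    ...   | inj₁ B≡B₀ = inj₁ B≡B₀
    ...   | inj₂ B∈λ with admissible-before δ C B next B∈ C-adm
    ...     | C∈λ , SC<TC = ⊥-elim (<-irrefl refl (begin-strict
      S C        <⟨ SC<TC ⟩
      Tz e T C   ≤⟨ ≼⇒≤ δ (Tz-monotone δ C B next C∈λ B∈λ) ⟩
      Tz e T B   ≤⟨ ≺⇒≤ δ (subst₂ (λ x y → x ≺⟨ δ ⟩ y) (S′-∉ B∉U) (S′-∈ C∈U) viol) ⟩
      S C        ∎))
      where open ≤-Reasoning

    T′-fails-forward : FailsDir (InSkew lam d) (T′ e S T U) B C → ⊥
    T′-fails-forward fails with FailsDir-view B C fails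
    ... | B∈ , C∈ , δ , next , viol with admissible-in-λ C C-adm C∈
    ...   | _ , SC<TC = <-irrefl refl (begin-strict
      S B        ≤⟨ ≼⇒≤ δ (S-monotone δ B C next (λ⊆ρ B B∈) (λ⊆ρ C C∈)) ⟩
      S C        <⟨ SC<TC ⟩
      Tz e T C   ≤⟨ ≺⇒≤ δ (subst₂ (λ x y → x ≺⟨ δ ⟩ y) (T′-∈ C∈U) (T′-∉ B∉U) viol) ⟩
      S B        ∎)
      where open ≤-Reasoning

    T′-fails-backward : FailsDir (InSkew lam d) (T′ e S T U) C B → Admissible B
    T′-fails-backward fails with FailsDir-view C B fails
    ... | C∈ , B∈ , δ , next , viol =
      inj₂ (B∈ , ≺-≼-trans δ (subst₂ (λ x y → x ≺⟨ δ ⟩ y) (T′-∉ B∉U) (T′-∈ C∈U) viol)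
                             (Tz-monotone δ C B next C∈ B∈))

    admissible-step : Fails ρ lam d e S T U B C → Admissible B
    admissible-step (inj₁ (inj₁ fails)) = S′-fails-forward fails
    admissible-step (inj₁ (inj₂ fails)) = S′-fails-backward fails
    admissible-step (inj₂ (inj₁ fails)) = ⊥-elim (T′-fails-forward fails)
    admissible-step (inj₂ (inj₂ fails)) = T′-fails-backward fails

  finalU-admissible : ∀ U seq → All Admissible U → IsSpanningTreeFrom ρ lam d e S T U seq →
                      All Admissible (finalU U seq)
  finalU-admissible U [] U-adm _ = U-adm
  finalU-admissible U ((B , C) ∷ seq) U-adm (_ , B∉U , C∈U , _ , fails , tree) =
    finalU-admissible (B ∷ U) seq
      (admissible-step U B C B∉U C∈U (lookup U-adm C∈U) fails ∷ U-adm) tree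

lemma2p10 : (N n : ℕ) → 1 ≤ n → n ≤ N →
    (ρ lam : Vec ℕ n) → IsPartition ρ → IsPartition lam →
    (r : ℕ) → 1 ≤ r → r ≤ n →
    row lam r + 1 ≡ row ρ r → (∀ i → ¬ (i ≡ r) → row lam i ≡ row ρ i) →
    (d e : ℕ) → d < e → e ≤ row lam 1 →
    (S T : Filling) →
    IsSkewSSYT N (InSkew ρ d) S → IsSkewSSYT N (InSkew lam e) T →
    (seq : List (Pos × Pos)) →
    IsSpanningTreeFrom ρ lam d e S T ((r , row ρ r) ∷ []) seq →
    ∀ p → p ∈ finalU ((r , row ρ r) ∷ []) seq → InSkew ρ e p
lemma2p10 N n _ _ ρ lam _ lam-partition r 1≤r _ row-r row-i d e _ e≤λ₁ S T S-ssyt T-ssyt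
          seq tree p p∈U =
  admissible⇒ρ/e e≤λ₁ p (lookup U-admissible p∈U)
  where
  open SpanningTree N ρ lam lam-partition r 1≤r row-r row-i d e S T S-ssyt T-ssyt
  U-admissible : All Admissible (finalU ((r , row ρ r) ∷ []) seq)
  U-admissible = finalU-admissible ((r , row ρ r) ∷ []) seq (inj₁ refl ∷ []) tree
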